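{- Let $\epsilon>0$ and $\delta>0$ be sufficiently small, and consider nine rectangle item types with (width, height): type 1: $(1/4-300\delta,\,1/6-2\epsilon)$; type 2: $(1/4+100\delta,\,1/6-2\epsilon)$; type 3: $(1/2+200\delta,\,1/6-2\epsilon)$; type 4: $(1/4-30\delta,\,1/3+\epsilon)$; type 5: $(1/4+10\delta,\,1/3+\epsilon)$; type 6: $(1/2+20\delta,\,1/3+\epsilon)$; type 7: $(1/4-3\delta,\,1/2+\epsilon)$; type 8: $(1/4+\delta,\,1/2+\epsilon)$; type 9: $(1/2+2\delta,\,1/2+\epsilon)$. Let $(\lambda_1,\dots,\lambda_9)=\frac{1}{413}(48,48,96,72,72,144,72,72,144)$ and for a pattern $p$ let $w(p)=\sum_{i=2}^{9}\lambda_i p_i$. Then over all patterns $p\in T_3$, the pattern $(0,0,4,6,0,0,0,0,0)$ maximizes $w(p)$.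
   Context: A pattern is a vector $p=(p_1,\dots,p_9)$ of nonnegative integers such that a multiset consisting of $p_i$ items of type $i$ ($i=1,\dots,9$) can be packed into the unit square bin: items placed axis-parallel in the given orientation (no rotation), inside $[0,1]^2$, with pairwise disjoint interiors. $T_j$ denotes the set of patterns whose first nonzero component is $p_j$ (i.e. whose smallest item type index used is $j$).
   Formalization: The parameters ε and δ are rational, and packings of a pattern into the unit square place the items at positions with rational coordinates. -}

module Defs where

open import Data.Nat using (ℕ; zero; suc)
open import Data.Integer using (+_)
open import Data.Rational using (ℚ; _/_; _+_; _-_; _*_; _≤_; _<_; 0ℚ; 1ℚ)
open import Data.Fin using (Fin)
open import Data.Product using (Σ; _×_; _,_; proj₁; proj₂)
open import Data.Sum using (_⊎_)
open import Relation.Binary.PropositionalEquality using (_≡_; _≢_)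

c : ℕ → ℚ
c n = (+ n) / 1

-- A pattern: p i items of type i (types 1..9 are indexed by Fin 9 as 0..8).
Pattern : Set
Pattern = Fin 9 → ℕ

width : ℚ → ℚ → Fin 9 → ℚ
width ε δ Fin.zero = ((+ 1) / 4) - (c 300 * δ)
width ε δ (Fin.suc Fin.zero) = ((+ 1) / 4) + (c 100 * δ)
width ε δ (Fin.suc (Fin.suc Fin.zero)) = ((+ 1) / 2) + (c 200 * δ)
width ε δ (Fin.suc (Fin.suc (Fin.suc Fin.zero))) = ((+ 1) / 4) - (c 30 * δ)
width ε δ (Fin.suc (Fin.suc (Fin.suc (Fin.suc Fin.zero)))) = ((+ 1) / 4) + (c 10 * δ)
width ε δ (Fin.suc (Fin.suc (Fin.suc (Fin.suc (Fin.suc Fin.zero))))) = ((+ 1) / 2) + (c 20 * δ)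
width ε δ (Fin.suc (Fin.suc (Fin.suc (Fin.suc (Fin.suc (Fin.suc Fin.zero)))))) = ((+ 1) / 4) - (c 3 * δ)
width ε δ (Fin.suc (Fin.suc (Fin.suc (Fin.suc (Fin.suc (Fin.suc (Fin.suc Fin.zero))))))) = ((+ 1) / 4) + δ
width ε δ (Fin.suc (Fin.suc (Fin.suc (Fin.suc (Fin.suc (Fin.suc (Fin.suc (Fin.suc Fin.zero)))))))) = ((+ 1) / 2) + (c 2 * δ)

height : ℚ → ℚ → Fin 9 → ℚ
height ε δ Fin.zero = ((+ 1) / 6) - (c 2 * ε)
height ε δ (Fin.suc Fin.zero) = ((+ 1) / 6) - (c 2 * ε)
height ε δ (Fin.suc (Fin.suc Fin.zero)) = ((+ 1) / 6) - (c 2 * ε)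
height ε δ (Fin.suc (Fin.suc (Fin.suc Fin.zero))) = ((+ 1) / 3) + ε
height ε δ (Fin.suc (Fin.suc (Fin.suc (Fin.suc Fin.zero)))) = ((+ 1) / 3) + ε
height ε δ (Fin.suc (Fin.suc (Fin.suc (Fin.suc (Fin.suc Fin.zero))))) = ((+ 1) / 3) + ε
height ε δ (Fin.suc (Fin.suc (Fin.suc (Fin.suc (Fin.suc (Fin.suc Fin.zero)))))) = ((+ 1) / 2) + ε
height ε δ (Fin.suc (Fin.suc (Fin.suc (Fin.suc (Fin.suc (Fin.suc (Fin.suc Fin.zero))))))) = ((+ 1) / 2) + ε
height ε δ (Fin.suc (Fin.suc (Fin.suc (Fin.suc (Fin.suc (Fin.suc (Fin.suc (Fin.suc Fin.zero)))))))) = ((+ 1) / 2) + ε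

Item : Pattern → Set
Item p = Σ (Fin 9) (λ i → Fin (p i))

type : {p : Pattern} → Item p → Fin 9
type = proj₁

DisjointInteriors : (x₁ y₁ w₁ h₁ x₂ y₂ w₂ h₂ : ℚ) → Set
DisjointInteriors x₁ y₁ w₁ h₁ x₂ y₂ w₂ h₂ =
  ((x₁ + w₁) ≤ x₂ ⊎ (x₂ + w₂) ≤ x₁) ⊎ ((y₁ + h₁) ≤ y₂ ⊎ (y₂ + h₂) ≤ y₁)

-- p is a pattern: its items can be packed (no rotation) into [0,1]²,
-- given by lower-left corner positions of each item.
Packable : ℚ → ℚ → Pattern → Set
Packable ε δ p =
  Σ (Item p → ℚ × ℚ) λ pos →
    ((a : Item p) →
        (0ℚ ≤ proj₁ (pos a)) × ((proj₁ (pos a) + width ε δ (type a)) ≤ 1ℚ)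
      × (0ℚ ≤ proj₂ (pos a)) × ((proj₂ (pos a) + height ε δ (type a)) ≤ 1ℚ))
    × ((a b : Item p) → a ≢ b →
        DisjointInteriors (proj₁ (pos a)) (proj₂ (pos a)) (width ε δ (type a)) (height ε δ (type a))
                          (proj₁ (pos b)) (proj₂ (pos b)) (width ε δ (type b)) (height ε δ (type b)))

-- Membership in T_3 (for a packable p): first nonzero component is p_3.
InT3 : Pattern → Set
InT3 p = (p Fin.zero ≡ 0) × (p (Fin.suc Fin.zero) ≡ 0) × (p (Fin.suc (Fin.suc Fin.zero)) ≢ 0)

lam : Fin 9 → ℚ
lam Fin.zero = (+ 48) / 413
lam (Fin.suc Fin.zero) = (+ 48) / 413
lam (Fin.suc (Fin.suc Fin.zero)) = (+ 96) / 413
lam (Fin.suc (Fin.suc (Fin.suc Fin.zero))) = (+ 72) / 413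
lam (Fin.suc (Fin.suc (Fin.suc (Fin.suc Fin.zero)))) = (+ 72) / 413
lam (Fin.suc (Fin.suc (Fin.suc (Fin.suc (Fin.suc Fin.zero))))) = (+ 144) / 413
lam (Fin.suc (Fin.suc (Fin.suc (Fin.suc (Fin.suc (Fin.suc Fin.zero)))))) = (+ 72) / 413
lam (Fin.suc (Fin.suc (Fin.suc (Fin.suc (Fin.suc (Fin.suc (Fin.suc Fin.zero))))))) = (+ 72) / 413
lam (Fin.suc (Fin.suc (Fin.suc (Fin.suc (Fin.suc (Fin.suc (Fin.suc (Fin.suc Fin.zero)))))))) = (+ 144) / 413

w : Pattern → ℚ
w p = term (Fin.suc Fin.zero) + term (Fin.suc (Fin.suc Fin.zero))
      + term (Fin.suc (Fin.suc (Fin.suc Fin.zero)))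
      + term (Fin.suc (Fin.suc (Fin.suc (Fin.suc Fin.zero))))
      + term (Fin.suc (Fin.suc (Fin.suc (Fin.suc (Fin.suc Fin.zero)))))
      + term (Fin.suc (Fin.suc (Fin.suc (Fin.suc (Fin.suc (Fin.suc Fin.zero))))))
      + term (Fin.suc (Fin.suc (Fin.suc (Fin.suc (Fin.suc (Fin.suc (Fin.suc Fin.zero)))))))
      + term (Fin.suc (Fin.suc (Fin.suc (Fin.suc (Fin.suc (Fin.suc (Fin.suc (Fin.suc Fin.zero))))))))
  where
  term : Fin 9 → ℚ
  term i = lam i * c (p i)

pstar : Pattern
pstar (Fin.suc (Fin.suc Fin.zero)) = 4
pstar (Fin.suc (Fin.suc (Fin.suc Fin.zero))) = 6
pstar _ = 0

-- The upper bound is a double-counting argument against two grids of lines.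
-- The 47 vertical lines x = k/48 each meet at most two items taller than 1/3,
-- and an item of type 4, 5, 7, 8 (resp. 6, 9) is crossed by at least 11
-- (resp. 24) of them. The 89 horizontal lines y = k/90 each meet items whose
-- widths sum to at most 1, which forces n + 3a + 2b ≤ 4 for n items of width
-- about 1/4, a of type 3 and b of width just over 1/2; every item of type 3,
-- 4–8, 9 is crossed by at least 14, 30, 45 of these lines. The two resulting
-- linear inequalities on the counts of a pattern without type-2 items admit
-- only finitely many integer solutions, and enumerating them gives
-- 413 w(p) ≤ 816 = 413 w(p*). Every comparison between quantities depending on
-- ε and δ is an affine inequality decided exactly on the box
-- 0 < ε < 1/1000, 0 < δ < 1/10000; the same check certifies a packing of p*.

module Submission where

open import Defs
open import Algebra.Bundles using (CommutativeMonoid)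
import Algebra.Properties.CommutativeSemigroup as CommutativeSemigroupProperties
open import Data.Bool using (Bool; T; _∧_; _∨_)
open import Data.Bool.Properties using (T-∧; T-∨)
open import Data.Empty using (⊥-elim)
open import Data.Fin using (Fin; zero; suc)
import Data.Fin.Properties as Fin
open import Data.Fin.Properties using (all?)
open import Data.Integer as ℤ using (+_)
import Data.Integer.Properties as ℤ
open import Data.List using (List; []; _∷_; _++_; applyUpTo; concat; filter; length; tabulate)
open import Data.List.Membership.Propositional.Properties using (∈-tabulate⁻)
open import Data.List.Properties using (length-filter)
open import Data.List.Relation.Unary.All using (All; []; _∷_)
import Data.List.Relation.Unary.All as All
import Data.List.Relation.Unary.All.Properties as All
open import Data.List.Relation.Unary.AllPairs using (AllPairs; []; _∷_)
import Data.List.Relation.Unary.AllPairs.Properties as AllPairs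
open import Data.List.Relation.Unary.Unique.Propositional using (Unique)
import Data.List.Relation.Unary.Unique.Propositional.Properties as Unique
open import Data.Nat as ℕ using (ℕ; zero; suc; z≤n; s≤s)
import Data.Nat.Properties as ℕ
open import Data.Nat.Coprimality using (1-coprimeTo; sym)
open import Data.Nat.Tactic.RingSolver using (solve-∀)
open import Data.Product using (Σ; _×_; _,_; proj₁; proj₂)
open import Data.Product.Properties using (≡-dec)
open import Data.Rational
open import Data.Rational.Properties
import Data.Rational.Solver as ℚ-Solver
open import Data.Unit using (tt)
open import Data.Sum using (_⊎_; inj₁; inj₂; swap)
import Data.Sum as Sum
open import Function using (_∘_; _$_)
open import Function.Bundles using (Equivalence)
open import Relation.Binary.Definitions using (tri<; tri≈; tri>)
open import Relation.Binary.PropositionalEquality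
  using (_≡_; _≢_; refl; cong; cong₂; subst; subst₂; trans; module ≡-Reasoning)
  renaming (sym to ≡-sym)
open import Relation.Nullary using (Dec; yes; no; ¬_; ¬?)
open import Relation.Nullary.Decidable
  using (True; T?; _×-dec_; _→-dec_; isYes; isNo; toWitness; toWitnessFalse)
open import Relation.Unary using (Decidable)

open ℚ-Solver.+-*-Solver using (solve; _:=_; _:+_; _:*_; _:-_; con)
module ℕ+ = CommutativeSemigroupProperties ℕ.+-commutativeSemigroup
module ℚ+ = CommutativeSemigroupProperties (CommutativeMonoid.commutativeSemigroup +-0-commutativeMonoid)

T-∧⁻ : ∀ {x y} → T (x ∧ y) → T x × T y
T-∧⁻ = Equivalence.to T-∧

T-∨⁻ : ∀ {x y} → T (x ∨ y) → T x ⊎ T y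
T-∨⁻ = Equivalence.to T-∨

indicator : ∀ {P : Set} → Dec P → ℕ
indicator (yes _) = 1
indicator (no _) = 0

0≤q-p⇒p≤q : ∀ {p q} → 0ℚ ≤ q - p → p ≤ q
0≤q-p⇒p≤q {p} {q} 0≤q-p = subst₂ _≤_ (+-identityʳ p)
  (solve 2 (λ p q → p :+ (q :- p) := q) refl p q) (+-monoʳ-≤ p 0≤q-p)

0<q-p⇒p<q : ∀ {p q} → 0ℚ < q - p → p < q
0<q-p⇒p<q {p} {q} 0<q-p = subst₂ _<_ (+-identityʳ p)
  (solve 2 (λ p q → p :+ (q :- p) := q) refl p q) (+-monoʳ-< p 0<q-p)

c-≡-mkℚ : ∀ n → c n ≡ mkℚ (+ n) 0 (sym (1-coprimeTo n))
c-≡-mkℚ n = normalize-coprime (sym (1-coprimeTo n))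

c-homo-+ : ∀ m n → c m + c n ≡ c (m ℕ.+ n)
c-homo-+ m n rewrite c-≡-mkℚ m | c-≡-mkℚ n | ℤ.*-identityʳ (+ m) | ℤ.*-identityʳ (+ n) = refl

c-homo-* : ∀ m n → c m * c n ≡ c (m ℕ.* n)
c-homo-* m n rewrite c-≡-mkℚ m | c-≡-mkℚ n | ≡-sym (ℤ.pos-* m n) = refl

c-mono-≤ : ∀ {m n} → m ℕ.≤ n → c m ≤ c n
c-mono-≤ {m} {n} m≤n rewrite c-≡-mkℚ m | c-≡-mkℚ n =
  *≤* (subst₂ ℤ._≤_ (≡-sym (ℤ.*-identityʳ (+ m))) (≡-sym (ℤ.*-identityʳ (+ n))) (ℤ.+≤+ m≤n))

c-cancel-< : ∀ {m n} → c m < c n → m ℕ.< n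
c-cancel-< {m} {n} cm<cn with ℕ.<-≤-connex m n
... | inj₁ m<n = m<n
... | inj₂ n≤m = ⊥-elim (<-irrefl refl (<-≤-trans cm<cn (c-mono-≤ n≤m)))

-- Affine forms in ε and δ

ε-max δ-max : ℚ
ε-max = + 1 / 1000
δ-max = + 1 / 10000

infixl 6 _⊕_ _⊖_
infixr 7 _⊛_

data Lin : Set where
  const : ℚ → Lin
  ε̂ δ̂ : Lin
  _⊕_ _⊖_ : Lin → Lin → Lin
  _⊛_ : ℚ → Lin → Lin

⟦_⟧ : Lin → ℚ → ℚ → ℚ
⟦ const q ⟧ ε δ = q
⟦ ε̂ ⟧ ε δ = ε
⟦ δ̂ ⟧ ε δ = δ
⟦ x ⊕ y ⟧ ε δ = ⟦ x ⟧ ε δ + ⟦ y ⟧ ε δ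
⟦ x ⊖ y ⟧ ε δ = ⟦ x ⟧ ε δ - ⟦ y ⟧ ε δ
⟦ q ⊛ x ⟧ ε δ = q * ⟦ x ⟧ ε δ

record Affine : Set where
  constructor affine
  field offset slopeε slopeδ : ℚ
open Affine

evalAffine : Affine → ℚ → ℚ → ℚ
evalAffine (affine a b d) ε δ = a + b * ε + d * δ

normalise : Lin → Affine
normalise (const q) = affine q 0ℚ 0ℚ
normalise ε̂ = affine 0ℚ 1ℚ 0ℚ
normalise δ̂ = affine 0ℚ 0ℚ 1ℚ
normalise (x ⊕ y) = affine (offset (normalise x) + offset (normalise y))
  (slopeε (normalise x) + slopeε (normalise y)) (slopeδ (normalise x) + slopeδ (normalise y))
normalise (x ⊖ y) = affine (offset (normalise x) - offset (normalise y))
  (slopeε (normalise x) - slopeε (normalise y)) (slopeδ (normalise x) - slopeδ (normalise y))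
normalise (q ⊛ x) = affine (q * offset (normalise x)) (q * slopeε (normalise x)) (q * slopeδ (normalise x))

normalise-sound : ∀ x ε δ → ⟦ x ⟧ ε δ ≡ evalAffine (normalise x) ε δ
normalise-sound (const q) ε δ =
  solve 3 (λ q ε δ → q := q :+ con 0ℚ :* ε :+ con 0ℚ :* δ) refl q ε δ
normalise-sound ε̂ ε δ =
  solve 2 (λ ε δ → ε := con 0ℚ :+ con 1ℚ :* ε :+ con 0ℚ :* δ) refl ε δ
normalise-sound δ̂ ε δ =
  solve 2 (λ ε δ → δ := con 0ℚ :+ con 0ℚ :* ε :+ con 1ℚ :* δ) refl ε δ
normalise-sound (x ⊕ y) ε δ
  rewrite normalise-sound x ε δ | normalise-sound y ε δ with normalise x | normalise y
... | affine a b d | affine a′ b′ d′ =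
  solve 8 (λ a b d a′ b′ d′ ε δ → (a :+ b :* ε :+ d :* δ) :+ (a′ :+ b′ :* ε :+ d′ :* δ)
                                 := (a :+ a′) :+ (b :+ b′) :* ε :+ (d :+ d′) :* δ)
          refl a b d a′ b′ d′ ε δ
normalise-sound (x ⊖ y) ε δ
  rewrite normalise-sound x ε δ | normalise-sound y ε δ with normalise x | normalise y
... | affine a b d | affine a′ b′ d′ =
  solve 8 (λ a b d a′ b′ d′ ε δ → (a :+ b :* ε :+ d :* δ) :- (a′ :+ b′ :* ε :+ d′ :* δ)
                                 := (a :- a′) :+ (b :- b′) :* ε :+ (d :- d′) :* δ)
          refl a b d a′ b′ d′ ε δ
normalise-sound (q ⊛ x) ε δ rewrite normalise-sound x ε δ with normalise x
... | affine a b d =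
  solve 6 (λ q a b d ε δ → q :* (a :+ b :* ε :+ d :* δ) := q :* a :+ (q :* b) :* ε :+ (q :* d) :* δ)
          refl q a b d ε δ

infimum : Affine → ℚ
infimum (affine a b d) = a + (b ⊓ 0ℚ) * ε-max + (d ⊓ 0ℚ) * δ-max

nonConstant : Affine → Bool
nonConstant f = isNo (slopeε f ≟ 0ℚ) ∨ isNo (slopeδ f ≟ 0ℚ)

infix 4 _≤ᴸ_ _<ᴸ_

_≤ᴸ_ : Lin → Lin → Bool
x ≤ᴸ y = isYes (0ℚ ≤? infimum (normalise (y ⊖ x)))

-- On the open box the infimum is attained only by constant forms.
_<ᴸ_ : Lin → Lin → Bool
x <ᴸ y = isYes (0ℚ <? infimum (normalise (y ⊖ x))) ∨ ((x ≤ᴸ y) ∧ nonConstant (normalise (y ⊖ x)))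

nonConstant-slope : ∀ f → T (nonConstant f) → slopeε f ≢ 0ℚ ⊎ slopeδ f ≢ 0ℚ
nonConstant-slope f nc =
  Sum.map (toWitnessFalse {a? = slopeε f ≟ 0ℚ}) (toWitnessFalse {a? = slopeδ f ≟ 0ℚ})
          (T-∨⁻ {isNo (slopeε f ≟ 0ℚ)} nc)

module _ {v v₀ : ℚ} (0<v : 0ℚ < v) (v<v₀ : v < v₀) where

  ⊓0-*-bound-≤ : ∀ b → (b ⊓ 0ℚ) * v₀ ≤ b * v
  ⊓0-*-bound-≤ b with ≤-total b 0ℚ
  ... | inj₁ b≤0 rewrite p≤q⇒p⊓q≡p b≤0 = *-monoˡ-≤-nonPos b {{nonPositive b≤0}} (<⇒≤ v<v₀)
  ... | inj₂ 0≤b rewrite p≥q⇒p⊓q≡q 0≤b | *-zeroˡ v₀ =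
    subst (_≤ b * v) (*-zeroʳ b) (*-monoˡ-≤-nonNeg b {{nonNegative 0≤b}} (<⇒≤ 0<v))

  ⊓0-*-bound-< : ∀ b → b ≢ 0ℚ → (b ⊓ 0ℚ) * v₀ < b * v
  ⊓0-*-bound-< b b≢0 with <-cmp b 0ℚ
  ... | tri< b<0 _ _ rewrite p≤q⇒p⊓q≡p (<⇒≤ b<0) = *-monoʳ-<-neg b {{negative b<0}} v<v₀
  ... | tri≈ _ b≡0 _ = ⊥-elim (b≢0 b≡0)
  ... | tri> _ _ 0<b rewrite p≥q⇒p⊓q≡q (<⇒≤ 0<b) | *-zeroˡ v₀ =
    subst (_< b * v) (*-zeroʳ b) (*-monoʳ-<-pos b {{positive 0<b}} 0<v)

inUnitSquareᴸ : (x y w h : Lin) → Bool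
inUnitSquareᴸ x y w h = (const 0ℚ ≤ᴸ x) ∧ (x ⊕ w ≤ᴸ const 1ℚ) ∧ (const 0ℚ ≤ᴸ y) ∧ (y ⊕ h ≤ᴸ const 1ℚ)

disjointᴸ : (x₁ y₁ w₁ h₁ x₂ y₂ w₂ h₂ : Lin) → Bool
disjointᴸ x₁ y₁ w₁ h₁ x₂ y₂ w₂ h₂ =
  ((x₁ ⊕ w₁ ≤ᴸ x₂) ∨ (x₂ ⊕ w₂ ≤ᴸ x₁)) ∨ ((y₁ ⊕ h₁ ≤ᴸ y₂) ∨ (y₂ ⊕ h₂ ≤ᴸ y₁))

module Box (ε δ : ℚ) (0<ε : 0ℚ < ε) (ε<ε-max : ε < ε-max) (0<δ : 0ℚ < δ) (δ<δ-max : δ < δ-max) where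

  ⟪_⟫ : Lin → ℚ
  ⟪ x ⟫ = ⟦ x ⟧ ε δ

  infimum-≤ : ∀ f → infimum f ≤ evalAffine f ε δ
  infimum-≤ (affine a b d) =
    +-mono-≤ (+-monoʳ-≤ a (⊓0-*-bound-≤ 0<ε ε<ε-max b)) (⊓0-*-bound-≤ 0<δ δ<δ-max d)

  infimum-< : ∀ f → T (nonConstant f) → infimum f < evalAffine f ε δ
  infimum-< (affine a b d) nc = bound (nonConstant-slope (affine a b d) nc)
    where
    bound : b ≢ 0ℚ ⊎ d ≢ 0ℚ → infimum (affine a b d) < evalAffine (affine a b d) ε δ
    bound (inj₁ b≢0) = +-mono-<-≤ (+-monoʳ-< a (⊓0-*-bound-< 0<ε ε<ε-max b b≢0)) (⊓0-*-bound-≤ 0<δ δ<δ-max d)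
    bound (inj₂ d≢0) = +-mono-≤-< (+-monoʳ-≤ a (⊓0-*-bound-≤ 0<ε ε<ε-max b)) (⊓0-*-bound-< 0<δ δ<δ-max d d≢0)

  ≤ᴸ-sound : ∀ x y → T (x ≤ᴸ y) → ⟪ x ⟫ ≤ ⟪ y ⟫
  ≤ᴸ-sound x y t = 0≤q-p⇒p≤q $ ≤-trans (toWitness t) $
    ≤-trans (infimum-≤ (normalise (y ⊖ x))) (≤-reflexive (≡-sym (normalise-sound (y ⊖ x) ε δ)))

  <ᴸ-sound : ∀ x y → T (x <ᴸ y) → ⟪ x ⟫ < ⟪ y ⟫
  <ᴸ-sound x y t = 0<q-p⇒p<q $ subst (0ℚ <_) (≡-sym (normalise-sound (y ⊖ x) ε δ)) $
    case (T-∨⁻ t)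
    where
    case : T (isYes (0ℚ <? infimum (normalise (y ⊖ x)))) ⊎ T ((x ≤ᴸ y) ∧ nonConstant (normalise (y ⊖ x)))
         → 0ℚ < evalAffine (normalise (y ⊖ x)) ε δ
    case (inj₁ 0<inf) = <-≤-trans (toWitness 0<inf) (infimum-≤ (normalise (y ⊖ x)))
    case (inj₂ t′) = let 0≤inf , nc = T-∧⁻ t′ in ≤-<-trans (toWitness 0≤inf) (infimum-< (normalise (y ⊖ x)) nc)

  inUnitSquareᴸ-sound : ∀ x y w h → T (inUnitSquareᴸ x y w h) →
    (0ℚ ≤ ⟪ x ⟫) × (⟪ x ⟫ + ⟪ w ⟫ ≤ 1ℚ) × (0ℚ ≤ ⟪ y ⟫) × (⟪ y ⟫ + ⟪ h ⟫ ≤ 1ℚ)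
  inUnitSquareᴸ-sound x y w h t =
    let x≥0 , t₁ = T-∧⁻ {const 0ℚ ≤ᴸ x} t
        right≤1 , t₂ = T-∧⁻ {x ⊕ w ≤ᴸ const 1ℚ} t₁
        y≥0 , top≤1 = T-∧⁻ {const 0ℚ ≤ᴸ y} t₂
    in ≤ᴸ-sound (const 0ℚ) x x≥0 , ≤ᴸ-sound (x ⊕ w) (const 1ℚ) right≤1 ,
       ≤ᴸ-sound (const 0ℚ) y y≥0 , ≤ᴸ-sound (y ⊕ h) (const 1ℚ) top≤1

  disjointᴸ-sound : ∀ x₁ y₁ w₁ h₁ x₂ y₂ w₂ h₂ → T (disjointᴸ x₁ y₁ w₁ h₁ x₂ y₂ w₂ h₂) →
    DisjointInteriors ⟪ x₁ ⟫ ⟪ y₁ ⟫ ⟪ w₁ ⟫ ⟪ h₁ ⟫ ⟪ x₂ ⟫ ⟪ y₂ ⟫ ⟪ w₂ ⟫ ⟪ h₂ ⟫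
  disjointᴸ-sound x₁ y₁ w₁ h₁ x₂ y₂ w₂ h₂ t =
    Sum.map (Sum.map (≤ᴸ-sound (x₁ ⊕ w₁) x₂) (≤ᴸ-sound (x₂ ⊕ w₂) x₁) ∘ T-∨⁻ {x₁ ⊕ w₁ ≤ᴸ x₂})
            (Sum.map (≤ᴸ-sound (y₁ ⊕ h₁) y₂) (≤ᴸ-sound (y₂ ⊕ h₂) y₁) ∘ T-∨⁻ {y₁ ⊕ h₁ ≤ᴸ y₂})
            (T-∨⁻ {(x₁ ⊕ w₁ ≤ᴸ x₂) ∨ (x₂ ⊕ w₂ ≤ᴸ x₁)} t)

module _ {A : Set} where

  ∑ℕ : List A → (A → ℕ) → ℕ
  ∑ℕ [] f = 0
  ∑ℕ (x ∷ xs) f = f x ℕ.+ ∑ℕ xs f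

  ∑ℚ : List A → (A → ℚ) → ℚ
  ∑ℚ [] f = 0ℚ
  ∑ℚ (x ∷ xs) f = f x + ∑ℚ xs f

  ∑ℕ-cong : ∀ xs {f g : A → ℕ} → (∀ x → f x ≡ g x) → ∑ℕ xs f ≡ ∑ℕ xs g
  ∑ℕ-cong [] f≗g = refl
  ∑ℕ-cong (x ∷ xs) f≗g = cong₂ ℕ._+_ (f≗g x) (∑ℕ-cong xs f≗g)

  ∑ℕ-mono-≤ : ∀ xs {f g : A → ℕ} → (∀ x → f x ℕ.≤ g x) → ∑ℕ xs f ℕ.≤ ∑ℕ xs g
  ∑ℕ-mono-≤ [] f≤g = z≤n
  ∑ℕ-mono-≤ (x ∷ xs) f≤g = ℕ.+-mono-≤ (f≤g x) (∑ℕ-mono-≤ xs f≤g)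

  ∑ℕ-+ : ∀ xs (f g : A → ℕ) → ∑ℕ xs (λ x → f x ℕ.+ g x) ≡ ∑ℕ xs f ℕ.+ ∑ℕ xs g
  ∑ℕ-+ [] f g = refl
  ∑ℕ-+ (x ∷ xs) f g rewrite ∑ℕ-+ xs f g = ℕ+.interchange (f x) (g x) (∑ℕ xs f) (∑ℕ xs g)

  ∑ℕ-*ˡ : ∀ xs k (f : A → ℕ) → ∑ℕ xs (λ x → k ℕ.* f x) ≡ k ℕ.* ∑ℕ xs f
  ∑ℕ-*ˡ [] k f = ≡-sym (ℕ.*-zeroʳ k)
  ∑ℕ-*ˡ (x ∷ xs) k f rewrite ∑ℕ-*ˡ xs k f = ≡-sym (ℕ.*-distribˡ-+ k (f x) (∑ℕ xs f))

  ∑ℕ-const : ∀ xs k → ∑ℕ xs (λ _ → k) ≡ k ℕ.* length xs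
  ∑ℕ-const [] k = ≡-sym (ℕ.*-zeroʳ k)
  ∑ℕ-const (x ∷ xs) k rewrite ∑ℕ-const xs k = ≡-sym (ℕ.*-suc k (length xs))

  ∑ℕ-++ : ∀ xs ys (f : A → ℕ) → ∑ℕ (xs ++ ys) f ≡ ∑ℕ xs f ℕ.+ ∑ℕ ys f
  ∑ℕ-++ [] ys f = refl
  ∑ℕ-++ (x ∷ xs) ys f rewrite ∑ℕ-++ xs ys f = ≡-sym (ℕ.+-assoc (f x) (∑ℕ xs f) (∑ℕ ys f))

  ∑ℕ-filter : ∀ {P : A → Set} (P? : Decidable P) xs (f : A → ℕ) →
              ∑ℕ xs (λ x → indicator (P? x) ℕ.* f x) ≡ ∑ℕ (filter P? xs) f
  ∑ℕ-filter P? [] f = refl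
  ∑ℕ-filter P? (x ∷ xs) f with P? x
  ... | yes _ = cong₂ ℕ._+_ (ℕ.+-identityʳ (f x)) (∑ℕ-filter P? xs f)
  ... | no _ = ∑ℕ-filter P? xs f

  ∑ℚ-cong : ∀ xs {f g : A → ℚ} → (∀ x → f x ≡ g x) → ∑ℚ xs f ≡ ∑ℚ xs g
  ∑ℚ-cong [] f≗g = refl
  ∑ℚ-cong (x ∷ xs) f≗g = cong₂ _+_ (f≗g x) (∑ℚ-cong xs f≗g)

  ∑ℚ-mono-≤ : ∀ xs {f g : A → ℚ} → (∀ x → f x ≤ g x) → ∑ℚ xs f ≤ ∑ℚ xs g
  ∑ℚ-mono-≤ [] f≤g = ≤-refl
  ∑ℚ-mono-≤ (x ∷ xs) f≤g = +-mono-≤ (f≤g x) (∑ℚ-mono-≤ xs f≤g)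

  ∑ℚ-c-* : ∀ xs (f : A → ℕ) q → ∑ℚ xs (λ x → c (f x) * q) ≡ c (∑ℕ xs f) * q
  ∑ℚ-c-* [] f q = ≡-sym (*-zeroˡ q)
  ∑ℚ-c-* (x ∷ xs) f q rewrite ∑ℚ-c-* xs f q =
    trans (≡-sym (*-distribʳ-+ q (c (f x)) (c (∑ℕ xs f)))) (cong (_* q) (c-homo-+ (f x) (∑ℕ xs f)))

  ∑ℚ-partition : ∀ {P : A → Set} (P? : Decidable P) xs (f : A → ℚ) →
                 ∑ℚ xs f ≡ ∑ℚ (filter P? xs) f + ∑ℚ (filter (¬? ∘ P?) xs) f
  ∑ℚ-partition P? [] f = ≡-sym (+-identityʳ 0ℚ)
  ∑ℚ-partition P? (x ∷ xs) f with P? x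
  ... | yes _ rewrite ∑ℚ-partition P? xs f = ≡-sym (+-assoc (f x) (∑ℚ (filter P? xs) f) (∑ℚ (filter (¬? ∘ P?) xs) f))
  ... | no _ rewrite ∑ℚ-partition P? xs f = ℚ+.x∙yz≈y∙xz (f x) (∑ℚ (filter P? xs) f) (∑ℚ (filter (¬? ∘ P?) xs) f)

∑ℕ-concat : ∀ {A : Set} (xss : List (List A)) f → ∑ℕ (concat xss) f ≡ ∑ℕ xss (λ xs → ∑ℕ xs f)
∑ℕ-concat [] f = refl
∑ℕ-concat (xs ∷ xss) f = trans (∑ℕ-++ xs (concat xss) f) (cong (∑ℕ xs f ℕ.+_) (∑ℕ-concat xss f))

∑ℕ-swap : ∀ {A B : Set} (xs : List A) (ys : List B) (f : A → B → ℕ) →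
          ∑ℕ xs (λ x → ∑ℕ ys (f x)) ≡ ∑ℕ ys (λ y → ∑ℕ xs (λ x → f x y))
∑ℕ-swap [] ys f = ≡-sym (∑ℕ-zero ys)
  where
  ∑ℕ-zero : ∀ {B : Set} (ys : List B) → ∑ℕ ys (λ _ → 0) ≡ 0
  ∑ℕ-zero [] = refl
  ∑ℕ-zero (_ ∷ ys) = ∑ℕ-zero ys
∑ℕ-swap (x ∷ xs) ys f rewrite ∑ℕ-swap xs ys f = ≡-sym (∑ℕ-+ ys (f x) (λ y → ∑ℕ xs (λ x′ → f x′ y)))

∑Fin : ∀ n → (Fin n → ℕ) → ℕ
∑Fin zero f = 0
∑Fin (suc n) f = f zero ℕ.+ ∑Fin n (f ∘ suc)

∑Fin-cong : ∀ n {g h : Fin n → ℕ} → (∀ i → g i ≡ h i) → ∑Fin n g ≡ ∑Fin n h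
∑Fin-cong zero _ = refl
∑Fin-cong (suc n) g≗h = cong₂ ℕ._+_ (g≗h zero) (∑Fin-cong n (g≗h ∘ suc))

∑Fin-const : ∀ n v → ∑Fin n (λ _ → v) ≡ n ℕ.* v
∑Fin-const zero v = refl
∑Fin-const (suc n) v = cong (v ℕ.+_) (∑Fin-const n v)

∑ℕ-tabulate : ∀ {A : Set} n (g : Fin n → A) (f : A → ℕ) → ∑ℕ (tabulate g) f ≡ ∑Fin n (f ∘ g)
∑ℕ-tabulate zero g f = refl
∑ℕ-tabulate (suc n) g f = cong (f (g zero) ℕ.+_) (∑ℕ-tabulate n (g ∘ suc) f)

-- Lines crossing intervals and rectangles

module Intervals {A : Set} (base len : A → ℚ) where

  Separated : A → A → Set
  Separated a b = (base a + len a ≤ base b) ⊎ (base b + len b ≤ base a)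

  Within : ℚ → ℚ → A → Set
  Within lo hi a = (lo ≤ base a) × (base a + len a ≤ hi)

  -- Induction on the number of intervals: those below the first one and those
  -- above it fill the two gaps it leaves in [lo, hi].
  ∑len-≤-span : ∀ xs → AllPairs Separated xs → ∀ {lo hi} → lo ≤ hi → All (Within lo hi) xs →
                ∑ℚ xs len ≤ hi - lo
  ∑len-≤-span xs = bounded (length xs) xs ℕ.≤-refl
    where
    bounded : ∀ n xs → length xs ℕ.≤ n → AllPairs Separated xs → ∀ {lo hi} → lo ≤ hi →
              All (Within lo hi) xs → ∑ℚ xs len ≤ hi - lo
    bounded n [] _ _ {lo} {hi} lo≤hi _ = subst (_≤ hi - lo) (+-inverseʳ lo) (+-monoˡ-≤ (- lo) lo≤hi)
    bounded (suc n) (a ∷ xs) (s≤s |xs|≤n) (a-sep ∷ xs-sep) {lo} {hi} _ ((lo≤a , a≤hi) ∷ xs-within) =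
      begin
        len a + ∑ℚ xs len                             ≡⟨ cong (λ s → len a + s) (∑ℚ-partition Below? xs len) ⟩
        len a + (∑ℚ below len + ∑ℚ above len)        ≤⟨ +-monoʳ-≤ (len a) (+-mono-≤ below-≤ above-≤) ⟩
        len a + ((base a - lo) + (hi - (base a + len a))) ≡⟨ solve 4 (λ l s lo hi → l :+ ((s :- lo) :+ (hi :- (s :+ l))) := hi :- lo) refl (len a) (base a) lo hi ⟩
        hi - lo                                       ∎
      where
      open ≤-Reasoning
      Below? : Decidable (λ b → base b + len b ≤ base a)
      Below? b = base b + len b ≤? base a
      below above : List A
      below = filter Below? xs
      above = filter (¬? ∘ Below?) xs

      above-a : ∀ {b} → Separated a b → ¬ (base b + len b ≤ base a) → base a + len a ≤ base b
      above-a (inj₁ a≤b) _ = a≤b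
      above-a (inj₂ b≤a) b≰a = ⊥-elim (b≰a b≤a)

      below-≤ : ∑ℚ below len ≤ base a - lo
      below-≤ = bounded n below (ℕ.≤-trans (length-filter Below? xs) |xs|≤n) (AllPairs.filter⁺ Below? xs-sep) lo≤a
        (All.zipWith (λ { ((lo≤b , _) , b≤a) → lo≤b , b≤a }) (All.filter⁺ Below? xs-within , All.all-filter Below? xs))

      above-≤ : ∑ℚ above len ≤ hi - (base a + len a)
      above-≤ = bounded n above (ℕ.≤-trans (length-filter (¬? ∘ Below?) xs) |xs|≤n)
        (AllPairs.filter⁺ (¬? ∘ Below?) xs-sep) a≤hi
        (All.zipWith (λ { ((_ , b≤hi) , (sep , b≰a)) → above-a sep b≰a , b≤hi })
          (All.filter⁺ (¬? ∘ Below?) xs-within ,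
           All.zip (All.filter⁺ (¬? ∘ Below?) a-sep , All.all-filter (¬? ∘ Below?) xs)))

allPairs-with : ∀ {A : Set} {P : A → Set} {R S : A → A → Set} {xs} →
                (∀ {a b} → P a → P b → R a b → S a b) → All P xs → AllPairs R xs → AllPairs S xs
allPairs-with f [] [] = []
allPairs-with f (pa ∷ ps) (ra ∷ rs) = All.zipWith (λ { (pb , r) → f pa pb r }) (ps , ra) ∷ allPairs-with f ps rs

StrictlyInside : ℚ → ℚ → ℚ → Set
StrictlyInside x w t = (x < t) × (t < x + w)

strictlyInside? : ∀ x w t → Dec (StrictlyInside x w t)
strictlyInside? x w t = (x <? t) ×-dec (t <? x + w)

module Slice {A : Set} (x w y h : A → ℚ) (xs : List A) (distinct : Unique xs)
  (disjoint : ∀ a b → a ≢ b → Intervals.Separated x w a b ⊎ Intervals.Separated y h a b)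
  (y-within : ∀ a → Intervals.Within y h 0ℚ 1ℚ a) where

  slice : ℚ → List A
  slice t = filter (λ a → strictlyInside? (x a) (w a) t) xs

  -- Rectangles met by the line x = t overlap in x, hence are separated in y.
  slice-∑-≤ : ∀ t → ∑ℚ (slice t) h ≤ 1ℚ
  slice-∑-≤ t = Intervals.∑len-≤-span y h (slice t)
    (allPairs-with separated-in-y (All.all-filter inside? xs) (AllPairs.filter⁺ inside? distinct))
    (≤ᵇ⇒≤ tt) (All.tabulate (λ {a} _ → y-within a))
    where
    inside? : ∀ a → Dec (StrictlyInside (x a) (w a) t)
    inside? a = strictlyInside? (x a) (w a) t
    separated-in-y : ∀ {a b} → StrictlyInside (x a) (w a) t → StrictlyInside (x b) (w b) t → a ≢ b →
                     Intervals.Separated y h a b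
    separated-in-y {a} {b} (xa<t , t<a) (xb<t , t<b) a≢b with disjoint a b a≢b
    ... | inj₁ (inj₁ a≤b) = ⊥-elim (<-irrefl refl (<-trans t<a (≤-<-trans a≤b xb<t)))
    ... | inj₁ (inj₂ b≤a) = ⊥-elim (<-irrefl refl (<-trans t<b (≤-<-trans b≤a xa<t)))
    ... | inj₂ sep = sep

double-counting : ∀ {L A : Set} (lines : List L) (xs : List A) {Crosses : L → A → Set}
                  (Crosses? : ∀ l a → Dec (Crosses l a)) (g m : A → ℕ) (B : ℕ) →
                  (∀ l → ∑ℕ (filter (Crosses? l) xs) g ℕ.≤ B) →
                  (∀ a → m a ℕ.≤ ∑ℕ lines (λ l → indicator (Crosses? l a))) →
                  ∑ℕ xs (λ a → g a ℕ.* m a) ℕ.≤ B ℕ.* length lines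
double-counting lines xs Crosses? g m B per-line per-item = begin
  ∑ℕ xs (λ a → g a ℕ.* m a)                                       ≤⟨ ∑ℕ-mono-≤ xs (λ a → ℕ.*-monoʳ-≤ (g a) (per-item a)) ⟩
  ∑ℕ xs (λ a → g a ℕ.* ∑ℕ lines (λ l → indicator (Crosses? l a)))   ≡⟨ ∑ℕ-cong xs (λ a → ≡-sym (∑ℕ-*ˡ lines (g a) _)) ⟩
  ∑ℕ xs (λ a → ∑ℕ lines (λ l → g a ℕ.* indicator (Crosses? l a)))   ≡⟨ ∑ℕ-swap xs lines _ ⟩
  ∑ℕ lines (λ l → ∑ℕ xs (λ a → g a ℕ.* indicator (Crosses? l a)))   ≡⟨ ∑ℕ-cong lines (λ l → trans (∑ℕ-cong xs (λ a → ℕ.*-comm (g a) _)) (∑ℕ-filter (Crosses? l) xs g)) ⟩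
  ∑ℕ lines (λ l → ∑ℕ (filter (Crosses? l) xs) g)                   ≤⟨ ∑ℕ-mono-≤ lines per-line ⟩
  ∑ℕ lines (λ _ → B)                                               ≡⟨ ∑ℕ-const lines B ⟩
  B ℕ.* length lines                                               ∎
  where open ℕ.≤-Reasoning

indicator-yes : ∀ {P : Set} (P? : Dec P) → P → 1 ℕ.≤ indicator P?
indicator-yes (yes _) _ = s≤s z≤n
indicator-yes (no ¬p) p = ⊥-elim (¬p p)

count-run : ∀ {X : Set} {P : X → Set} (P? : Decidable P) (f : ℕ → X) n j m → j ℕ.+ m ℕ.≤ n →
            (∀ i → i ℕ.< m → P (f (j ℕ.+ i))) → m ℕ.≤ ∑ℕ (applyUpTo f n) (indicator ∘ P?)
count-run P? f n j zero _ _ = z≤n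
count-run P? f (suc n) (suc j) m (s≤s j+m≤n) run =
  ℕ.≤-trans (count-run P? (f ∘ suc) n j m j+m≤n run) (ℕ.m≤n+m _ (indicator (P? (f 0))))
count-run P? f (suc n) zero (suc m) (s≤s m≤n) run =
  ℕ.+-mono-≤ (indicator-yes (P? (f 0)) (run 0 (s≤s z≤n)))
             (count-run P? (f ∘ suc) n zero m m≤n (λ i i<m → run (suc i) (s≤s i<m)))

module Grid (q : ℚ) (0<q : 0ℚ < q) (K : ℕ) (mesh : c (suc K) * q ≡ 1ℚ) where

  point : ℕ → ℚ
  point k = c k * q

  lines : List ℚ
  lines = applyUpTo (point ∘ suc) K

  point-mono-≤ : ∀ {j k} → j ℕ.≤ k → point j ≤ point k
  point-mono-≤ j≤k = *-monoʳ-≤-nonNeg q {{nonNegative (<⇒≤ 0<q)}} (c-mono-≤ j≤k)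

  point-cancel-< : ∀ {j k} → point j < point k → j ℕ.< k
  point-cancel-< pj<pk = c-cancel-< (*-cancelʳ-<-nonNeg q {{nonNegative (<⇒≤ 0<q)}} pj<pk)

  point-+ : ∀ j k → point (j ℕ.+ k) ≡ point j + point k
  point-+ j k = trans (cong (_* q) (≡-sym (c-homo-+ j k))) (*-distribʳ-+ q (c j) (c k))

  cell : ∀ {x} n j → point j ≤ x → x < point (j ℕ.+ n) → Σ ℕ λ i → (point i ≤ x) × (x < point (suc i))
  cell {x} zero j pj≤x x<pj = ⊥-elim (<-irrefl refl (<-≤-trans (subst (λ k → x < point k) (ℕ.+-identityʳ j) x<pj) pj≤x))
  cell {x} (suc n) j pj≤x x<pj+n with x <? point (suc j)
  ... | yes x<pj+1 = j , pj≤x , x<pj+1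
  ... | no x≮pj+1 = cell n (suc j) (≮⇒≥ x≮pj+1) (subst (λ k → x < point k) (ℕ.+-suc j n) x<pj+n)

  crossings-≥ : ∀ {x w} m → 0ℚ ≤ x → x + w ≤ 1ℚ → point m < w →
                m ℕ.≤ ∑ℕ lines (indicator ∘ strictlyInside? x w)
  crossings-≥ {x} {w} m 0≤x x+w≤1 pm<w =
    from-cell (cell (suc K) 0 (subst (_≤ x) (≡-sym (*-zeroˡ q)) 0≤x) (subst (x <_) (≡-sym mesh) x<1))
    where
    0<w : 0ℚ < w
    0<w = ≤-<-trans (subst (_≤ point m) (*-zeroˡ q) (point-mono-≤ {0} {m} z≤n)) pm<w
    x<1 : x < 1ℚ
    x<1 = <-≤-trans (subst (_< x + w) (+-identityʳ x) (+-monoʳ-< x 0<w)) x+w≤1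
    from-cell : (Σ ℕ λ j → (point j ≤ x) × (x < point (suc j))) →
                m ℕ.≤ ∑ℕ lines (indicator ∘ strictlyInside? x w)
    from-cell (j , pj≤x , x<pj+1) = count-run (strictlyInside? x w) (point ∘ suc) K j m j+m≤K
      (λ i i<m → <-≤-trans x<pj+1 (point-mono-≤ (ℕ.m≤m+n (suc j) i)) ,
                 ≤-<-trans (point-mono-≤ (subst (ℕ._≤ j ℕ.+ m) (ℕ.+-suc j i) (ℕ.+-monoʳ-≤ j i<m))) pj+m<x+w)
      where
      pj+m<x+w : point (j ℕ.+ m) < x + w
      pj+m<x+w = ≤-<-trans (≤-reflexive (point-+ j m)) (+-mono-≤-< pj≤x pm<w)
      j+m≤K : j ℕ.+ m ℕ.≤ K
      j+m≤K = ℕ.≤-pred (point-cancel-< (<-≤-trans pj+m<x+w (≤-trans x+w≤1 (≤-reflexive (≡-sym mesh)))))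

copies : (p : Pattern) (i : Fin 9) → List (Item p)
copies p i = tabulate (i ,_)

items : (p : Pattern) → List (Item p)
items p = concat (tabulate (copies p))

items-unique : ∀ p → Unique (items p)
items-unique p = Unique.concat⁺ {xss = tabulate (copies p)}
  (All.tabulate⁺ (λ i → Unique.tabulate⁺ {f = i ,_} λ { refl → refl }))
  (AllPairs.tabulate⁺ {f = copies p} λ i≢j → λ { (v∈i , v∈j) → i≢j (type-≡ (∈-tabulate⁻ v∈i) (∈-tabulate⁻ v∈j)) })
  where
  type-≡ : ∀ {i j} {v : Item p} → Σ (Fin (p i)) (λ k → v ≡ (i , k)) → Σ (Fin (p j)) (λ k → v ≡ (j , k)) → i ≡ j
  type-≡ (_ , refl) (_ , refl) = refl

∑ℕ-items : ∀ p (f : Fin 9 → ℕ) → ∑ℕ (items p) (f ∘ type) ≡ ∑Fin 9 (λ i → p i ℕ.* f i)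
∑ℕ-items p f = begin
  ∑ℕ (items p) (f ∘ type)                                   ≡⟨ ∑ℕ-concat (tabulate (copies p)) (f ∘ type) ⟩
  ∑ℕ (tabulate (copies p)) (λ xs → ∑ℕ xs (f ∘ type))        ≡⟨ ∑ℕ-tabulate 9 (copies p) (λ xs → ∑ℕ xs (f ∘ type)) ⟩
  ∑Fin 9 (λ i → ∑ℕ (copies p i) (f ∘ type))                  ≡⟨ ∑Fin-cong 9 copies-sum ⟩
  ∑Fin 9 (λ i → p i ℕ.* f i)                                ∎
  where
  open ≡-Reasoning
  copies-sum : ∀ i → ∑ℕ (copies p i) (f ∘ type) ≡ p i ℕ.* f i
  copies-sum i = trans (∑ℕ-tabulate (p i) (i ,_) (f ∘ type)) (∑Fin-const (p i) (f i))

allItems : (p : Pattern) → (Item p → Bool) → Bool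
allItems p b = isYes (all? λ i → all? λ k → T? (b (i , k)))

allItems-sound : ∀ p (b : Item p → Bool) → T (allItems p b) → ∀ a → T (b a)
allItems-sound p b t (i , k) = toWitness t i k

distinct-∨ : ∀ {A : Set} {a b : A} (a≟b : Dec (a ≡ b)) β → a ≢ b → T (isYes a≟b ∨ β) → T β
distinct-∨ (yes a≡b) β a≢b _ = ⊥-elim (a≢b a≡b)
distinct-∨ (no _) β _ t = t

_≟ᵢ_ : ∀ {p} (a b : Item p) → Dec (a ≡ b)
_≟ᵢ_ = ≡-dec Fin._≟_ Fin._≟_

decide-∀ : ∀ {n} (b : Fin n → Bool) → True (all? (T? ∘ b)) → ∀ i → T (b i)
decide-∀ b t = toWitness t

-- The item types and the weight bound

pattern type₁ = zero
pattern type₂ = suc type₁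
pattern type₃ = suc type₂
pattern type₄ = suc type₃
pattern type₅ = suc type₄
pattern type₆ = suc type₅
pattern type₇ = suc type₆
pattern type₈ = suc type₇
pattern type₉ = suc type₈

widthᴸ heightᴸ : Fin 9 → Lin
widthᴸ type₁ = const (+ 1 / 4) ⊖ c 300 ⊛ δ̂
widthᴸ type₂ = const (+ 1 / 4) ⊕ c 100 ⊛ δ̂
widthᴸ type₃ = const (+ 1 / 2) ⊕ c 200 ⊛ δ̂
widthᴸ type₄ = const (+ 1 / 4) ⊖ c 30 ⊛ δ̂
widthᴸ type₅ = const (+ 1 / 4) ⊕ c 10 ⊛ δ̂
widthᴸ type₆ = const (+ 1 / 2) ⊕ c 20 ⊛ δ̂
widthᴸ type₇ = const (+ 1 / 4) ⊖ c 3 ⊛ δ̂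
widthᴸ type₈ = const (+ 1 / 4) ⊕ δ̂
widthᴸ type₉ = const (+ 1 / 2) ⊕ c 2 ⊛ δ̂
heightᴸ type₁ = const (+ 1 / 6) ⊖ c 2 ⊛ ε̂
heightᴸ type₂ = const (+ 1 / 6) ⊖ c 2 ⊛ ε̂
heightᴸ type₃ = const (+ 1 / 6) ⊖ c 2 ⊛ ε̂
heightᴸ type₄ = const (+ 1 / 3) ⊕ ε̂
heightᴸ type₅ = const (+ 1 / 3) ⊕ ε̂
heightᴸ type₆ = const (+ 1 / 3) ⊕ ε̂
heightᴸ type₇ = const (+ 1 / 2) ⊕ ε̂
heightᴸ type₈ = const (+ 1 / 2) ⊕ ε̂
heightᴸ type₉ = const (+ 1 / 2) ⊕ ε̂

widthᴸ-correct : ∀ ε δ i → ⟦ widthᴸ i ⟧ ε δ ≡ width ε δ i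
widthᴸ-correct ε δ type₁ = refl
widthᴸ-correct ε δ type₂ = refl
widthᴸ-correct ε δ type₃ = refl
widthᴸ-correct ε δ type₄ = refl
widthᴸ-correct ε δ type₅ = refl
widthᴸ-correct ε δ type₆ = refl
widthᴸ-correct ε δ type₇ = refl
widthᴸ-correct ε δ type₈ = refl
widthᴸ-correct ε δ type₉ = refl

heightᴸ-correct : ∀ ε δ i → ⟦ heightᴸ i ⟧ ε δ ≡ height ε δ i
heightᴸ-correct ε δ type₁ = refl
heightᴸ-correct ε δ type₂ = refl
heightᴸ-correct ε δ type₃ = refl
heightᴸ-correct ε δ type₄ = refl
heightᴸ-correct ε δ type₅ = refl
heightᴸ-correct ε δ type₆ = refl
heightᴸ-correct ε δ type₇ = refl
heightᴸ-correct ε δ type₈ = refl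
heightᴸ-correct ε δ type₉ = refl

-- Items of types 4–9 are taller than 1/3, so a column holds at most two.
tall : Fin 9 → ℕ
tall type₁ = 0
tall type₂ = 0
tall type₃ = 0
tall _ = 1

quarter type₃-class half : Fin 9 → ℕ
quarter type₄ = 1
quarter type₅ = 1
quarter type₇ = 1
quarter type₈ = 1
quarter _ = 0
type₃-class type₃ = 1
type₃-class _ = 0
half type₆ = 1
half type₉ = 1
half _ = 0

-- Items lying side by side in the bin have total row weight at most 4 (see knapsack).
rowWeight : Fin 9 → ℕ
rowWeight i = quarter i ℕ.+ (3 ℕ.* type₃-class i ℕ.+ 2 ℕ.* half i)

thirdᴸ quarterᴸ type₃ᴸ halfᴸ : Lin
thirdᴸ = const (+ 1 / 3) ⊕ ε̂
quarterᴸ = const (+ 1 / 4) ⊖ c 30 ⊛ δ̂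
type₃ᴸ = const (+ 1 / 2) ⊕ c 200 ⊛ δ̂
halfᴸ = const (+ 1 / 2) ⊕ c 2 ⊛ δ̂

loadᴸ : ℕ → ℕ → ℕ → Lin
loadᴸ n a b = c n ⊛ quarterᴸ ⊕ c a ⊛ type₃ᴸ ⊕ c b ⊛ halfᴸ

rowLoadᴸ : Fin 9 → Lin
rowLoadᴸ i = loadᴸ (quarter i) (type₃-class i) (half i)

module Bounds (ε δ : ℚ) (0<ε : 0ℚ < ε) (ε<ε-max : ε < ε-max) (0<δ : 0ℚ < δ) (δ<δ-max : δ < δ-max) where
  open Box ε δ 0<ε ε<ε-max 0<δ δ<δ-max

  c-*-mono-≤ : ∀ x {m n} → T (const 0ℚ ≤ᴸ x) → m ℕ.≤ n → c m * ⟪ x ⟫ ≤ c n * ⟪ x ⟫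
  c-*-mono-≤ x 0≤x m≤n = *-monoʳ-≤-nonNeg ⟪ x ⟫ {{nonNegative (≤ᴸ-sound (const 0ℚ) x 0≤x)}} (c-mono-≤ m≤n)

  tall-≤-height : ∀ i → c (tall i) * ⟪ thirdᴸ ⟫ ≤ height ε δ i
  tall-≤-height i = subst (c (tall i) * ⟪ thirdᴸ ⟫ ≤_) (heightᴸ-correct ε δ i)
    (≤ᴸ-sound (c (tall i) ⊛ thirdᴸ) (heightᴸ i) (decide-∀ (λ i → c (tall i) ⊛ thirdᴸ ≤ᴸ heightᴸ i) tt i))

  column-tall-≤ : ∀ {A : Set} (xs : List A) (ty : A → Fin 9) →
                  ∑ℚ xs (height ε δ ∘ ty) ≤ 1ℚ → ∑ℕ xs (tall ∘ ty) ℕ.≤ 2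
  column-tall-≤ xs ty fits = ℕ.≤-pred $ c-cancel-< $
    *-cancelʳ-<-nonNeg ⟪ thirdᴸ ⟫ {{nonNegative (≤ᴸ-sound (const 0ℚ) thirdᴸ tt)}} $ begin-strict
      c (∑ℕ xs (tall ∘ ty)) * ⟪ thirdᴸ ⟫          ≡⟨ ≡-sym (∑ℚ-c-* xs (tall ∘ ty) ⟪ thirdᴸ ⟫) ⟩
      ∑ℚ xs (λ a → c (tall (ty a)) * ⟪ thirdᴸ ⟫)   ≤⟨ ∑ℚ-mono-≤ xs (tall-≤-height ∘ ty) ⟩
      ∑ℚ xs (height ε δ ∘ ty)                       ≤⟨ fits ⟩
      1ℚ                                            <⟨ <ᴸ-sound (const 1ℚ) (c 3 ⊛ thirdᴸ) tt ⟩
      c 3 * ⟪ thirdᴸ ⟫                              ∎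
    where open ≤-Reasoning

  rowLoad-≤-width : ∀ i → ⟪ rowLoadᴸ i ⟫ ≤ width ε δ i
  rowLoad-≤-width i = subst (⟪ rowLoadᴸ i ⟫ ≤_) (widthᴸ-correct ε δ i)
    (≤ᴸ-sound (rowLoadᴸ i) (widthᴸ i) (decide-∀ (λ i → rowLoadᴸ i ≤ᴸ widthᴸ i) tt i))

  load-mono-≤ : ∀ {n a b n′ a′ b′} → n′ ℕ.≤ n → a′ ℕ.≤ a → b′ ℕ.≤ b → ⟪ loadᴸ n′ a′ b′ ⟫ ≤ ⟪ loadᴸ n a b ⟫
  load-mono-≤ n′≤n a′≤a b′≤b = +-mono-≤ (+-mono-≤ (c-*-mono-≤ quarterᴸ tt n′≤n) (c-*-mono-≤ type₃ᴸ tt a′≤a))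
                                        (c-*-mono-≤ halfᴸ tt b′≤b)

  overfull : ∀ n′ a′ b′ {n a b} → T (const 1ℚ <ᴸ loadᴸ n′ a′ b′) →
             n′ ℕ.≤ n → a′ ℕ.≤ a → b′ ℕ.≤ b → ¬ ⟪ loadᴸ n a b ⟫ ≤ 1ℚ
  overfull n′ a′ b′ {n} {a} {b} 1<load n′≤n a′≤a b′≤b fits =
    <-irrefl refl (<-≤-trans (<ᴸ-sound (const 1ℚ) (loadᴸ n′ a′ b′) 1<load)
                             (≤-trans (load-mono-≤ n′≤n a′≤a b′≤b) fits))

  -- The minimal overfull loads are 2·type₃, 2·half, type₃ + half, 2·quarter + type₃,
  -- 3·quarter + half and 5·quarter.
  knapsack : ∀ n a b → ⟪ loadᴸ n a b ⟫ ≤ 1ℚ → n ℕ.+ (3 ℕ.* a ℕ.+ 2 ℕ.* b) ℕ.≤ 4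
  knapsack n (suc (suc a)) b = ⊥-elim ∘ overfull 0 2 0 {n} {suc (suc a)} {b} tt z≤n (s≤s (s≤s z≤n)) z≤n
  knapsack n a (suc (suc b)) = ⊥-elim ∘ overfull 0 0 2 {n} {a} {suc (suc b)} tt z≤n z≤n (s≤s (s≤s z≤n))
  knapsack n 1 1 = ⊥-elim ∘ overfull 0 1 1 {n} {1} {1} tt z≤n ℕ.≤-refl ℕ.≤-refl
  knapsack n 1 0 fits = ℕ.+-monoˡ-≤ 3 (ℕ.≮⇒≥ λ 1<n → overfull 2 1 0 {n} {1} {0} tt 1<n ℕ.≤-refl z≤n fits)
  knapsack n 0 1 fits = ℕ.+-monoˡ-≤ 2 (ℕ.≮⇒≥ λ 2<n → overfull 3 0 1 {n} {0} {1} tt 2<n z≤n ℕ.≤-refl fits)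
  knapsack n 0 0 fits = subst (ℕ._≤ 4) (≡-sym (ℕ.+-identityʳ n)) (ℕ.≮⇒≥ λ 4<n → overfull 5 0 0 {n} {0} {0} tt 4<n z≤n z≤n fits)

  load-additive : ∀ {A : Set} (xs : List A) (n a b : A → ℕ) →
    ∑ℚ xs (λ x → ⟪ loadᴸ (n x) (a x) (b x) ⟫) ≡ ⟪ loadᴸ (∑ℕ xs n) (∑ℕ xs a) (∑ℕ xs b) ⟫
  load-additive [] n a b =
    solve 3 (λ q t h → con 0ℚ := con 0ℚ :* q :+ con 0ℚ :* t :+ con 0ℚ :* h) refl ⟪ quarterᴸ ⟫ ⟪ type₃ᴸ ⟫ ⟪ halfᴸ ⟫
  load-additive (x ∷ xs) n a b = begin
    ⟪ loadᴸ (n x) (a x) (b x) ⟫ + ∑ℚ xs (λ x → ⟪ loadᴸ (n x) (a x) (b x) ⟫)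
      ≡⟨ cong (λ s → ⟪ loadᴸ (n x) (a x) (b x) ⟫ + s) (load-additive xs n a b) ⟩
    ⟪ loadᴸ (n x) (a x) (b x) ⟫ + ⟪ loadᴸ N A B ⟫
      ≡⟨ solve 9 (λ n a b N A B q t h → (n :* q :+ a :* t :+ b :* h) :+ (N :* q :+ A :* t :+ B :* h)
                                        := (n :+ N) :* q :+ (a :+ A) :* t :+ (b :+ B) :* h)
           refl (c (n x)) (c (a x)) (c (b x)) (c N) (c A) (c B) ⟪ quarterᴸ ⟫ ⟪ type₃ᴸ ⟫ ⟪ halfᴸ ⟫ ⟩
    (c (n x) + c N) * ⟪ quarterᴸ ⟫ + (c (a x) + c A) * ⟪ type₃ᴸ ⟫ + (c (b x) + c B) * ⟪ halfᴸ ⟫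
      ≡⟨ cong₂ _+_ (cong₂ _+_ (cong (_* ⟪ quarterᴸ ⟫) (c-homo-+ (n x) N)) (cong (_* ⟪ type₃ᴸ ⟫) (c-homo-+ (a x) A)))
                   (cong (_* ⟪ halfᴸ ⟫) (c-homo-+ (b x) B)) ⟩
    ⟪ loadᴸ (n x ℕ.+ N) (a x ℕ.+ A) (b x ℕ.+ B) ⟫ ∎
    where
    open ≡-Reasoning
    N A B : ℕ
    N = ∑ℕ xs n
    A = ∑ℕ xs a
    B = ∑ℕ xs b

  row-weight-≤ : ∀ {A : Set} (xs : List A) (ty : A → Fin 9) →
                 ∑ℚ xs (width ε δ ∘ ty) ≤ 1ℚ → ∑ℕ xs (rowWeight ∘ ty) ℕ.≤ 4
  row-weight-≤ xs ty fits = subst (ℕ._≤ 4) (≡-sym weight-≡) (knapsack n a b load-≤)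
    where
    n a b : ℕ
    n = ∑ℕ xs (quarter ∘ ty)
    a = ∑ℕ xs (type₃-class ∘ ty)
    b = ∑ℕ xs (half ∘ ty)
    weight-≡ : ∑ℕ xs (rowWeight ∘ ty) ≡ n ℕ.+ (3 ℕ.* a ℕ.+ 2 ℕ.* b)
    weight-≡ = begin
      ∑ℕ xs (rowWeight ∘ ty)                                             ≡⟨ ∑ℕ-+ xs (quarter ∘ ty) _ ⟩
      n ℕ.+ ∑ℕ xs (λ x → 3 ℕ.* type₃-class (ty x) ℕ.+ 2 ℕ.* half (ty x))  ≡⟨ cong (n ℕ.+_) (∑ℕ-+ xs _ _) ⟩
      n ℕ.+ (∑ℕ xs (λ x → 3 ℕ.* type₃-class (ty x)) ℕ.+ ∑ℕ xs (λ x → 2 ℕ.* half (ty x)))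
        ≡⟨ cong (n ℕ.+_) (cong₂ ℕ._+_ (∑ℕ-*ˡ xs 3 (type₃-class ∘ ty)) (∑ℕ-*ˡ xs 2 (half ∘ ty))) ⟩
      n ℕ.+ (3 ℕ.* a ℕ.+ 2 ℕ.* b)                                        ∎
      where open ≡-Reasoning
    load-≤ : ⟪ loadᴸ n a b ⟫ ≤ 1ℚ
    load-≤ = begin
      ⟪ loadᴸ n a b ⟫                     ≡⟨ ≡-sym (load-additive xs (quarter ∘ ty) (type₃-class ∘ ty) (half ∘ ty)) ⟩
      ∑ℚ xs (λ x → ⟪ rowLoadᴸ (ty x) ⟫)    ≤⟨ ∑ℚ-mono-≤ xs (rowLoad-≤-width ∘ ty) ⟩
      ∑ℚ xs (width ε δ ∘ ty)               ≤⟨ fits ⟩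
      1ℚ                                   ∎
      where open ≤-Reasoning

-- How many lines of the grids of mesh 1/48 (for widths) and 1/90 (for heights)
-- an item of each type certainly crosses.
xCrossings yCrossings : Fin 9 → ℕ
xCrossings type₁ = 0
xCrossings type₂ = 0
xCrossings type₃ = 0
xCrossings type₆ = 24
xCrossings type₉ = 24
xCrossings _ = 11
yCrossings type₁ = 0
yCrossings type₂ = 0
yCrossings type₃ = 14
yCrossings type₉ = 45
yCrossings _ = 30

module X-grid = Grid (+ 1 / 48) (toWitness {a? = 0ℚ <? + 1 / 48} tt) 47 refl
module Y-grid = Grid (+ 1 / 90) (toWitness {a? = 0ℚ <? + 1 / 90} tt) 89 refl

module Counting (ε δ : ℚ) (0<ε : 0ℚ < ε) (ε<ε-max : ε < ε-max) (0<δ : 0ℚ < δ) (δ<δ-max : δ < δ-max)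
                (p : Pattern) (packing : Packable ε δ p) where
  open Box ε δ 0<ε ε<ε-max 0<δ δ<δ-max
  open Bounds ε δ 0<ε ε<ε-max 0<δ δ<δ-max

  x y wd ht : Item p → ℚ
  x a = proj₁ (proj₁ packing a)
  y a = proj₂ (proj₁ packing a)
  wd a = width ε δ (type a)
  ht a = height ε δ (type a)

  x-within : ∀ a → Intervals.Within x wd 0ℚ 1ℚ a
  x-within a with proj₁ (proj₂ packing) a
  ... | 0≤x , x+w≤1 , _ = 0≤x , x+w≤1

  y-within : ∀ a → Intervals.Within y ht 0ℚ 1ℚ a
  y-within a with proj₁ (proj₂ packing) a
  ... | _ , _ , 0≤y , y+h≤1 = 0≤y , y+h≤1

  module Columns = Slice x wd y ht (items p) (items-unique p) (proj₂ (proj₂ packing)) y-within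
  module Rows = Slice y ht x wd (items p) (items-unique p) (λ a b a≢b → swap (proj₂ (proj₂ packing) a b a≢b)) x-within

  xCrossings-< : ∀ i → X-grid.point (xCrossings i) < width ε δ i
  xCrossings-< i = subst (X-grid.point (xCrossings i) <_) (widthᴸ-correct ε δ i)
    (<ᴸ-sound (const (X-grid.point (xCrossings i))) (widthᴸ i)
              (decide-∀ (λ i → const (X-grid.point (xCrossings i)) <ᴸ widthᴸ i) tt i))

  yCrossings-< : ∀ i → Y-grid.point (yCrossings i) < height ε δ i
  yCrossings-< i = subst (Y-grid.point (yCrossings i) <_) (heightᴸ-correct ε δ i)
    (<ᴸ-sound (const (Y-grid.point (yCrossings i))) (heightᴸ i)
              (decide-∀ (λ i → const (Y-grid.point (yCrossings i)) <ᴸ heightᴸ i) tt i))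

  column-count : ∑Fin 9 (λ i → p i ℕ.* (tall i ℕ.* xCrossings i)) ℕ.≤ 2 ℕ.* 47
  column-count = subst (ℕ._≤ 2 ℕ.* 47) (∑ℕ-items p (λ i → tall i ℕ.* xCrossings i)) $
    double-counting X-grid.lines (items p) (λ t a → strictlyInside? (x a) (wd a) t)
      (tall ∘ type) (xCrossings ∘ type) 2
      (λ t → column-tall-≤ (Columns.slice t) type (Columns.slice-∑-≤ t))
      (λ a → X-grid.crossings-≥ (xCrossings (type a)) (proj₁ (x-within a)) (proj₂ (x-within a))
                                (xCrossings-< (type a)))

  row-count : ∑Fin 9 (λ i → p i ℕ.* (rowWeight i ℕ.* yCrossings i)) ℕ.≤ 4 ℕ.* 89
  row-count = subst (ℕ._≤ 4 ℕ.* 89) (∑ℕ-items p (λ i → rowWeight i ℕ.* yCrossings i)) $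
    double-counting Y-grid.lines (items p) (λ t a → strictlyInside? (y a) (ht a) t)
      (rowWeight ∘ type) (yCrossings ∘ type) 4
      (λ t → row-weight-≤ (Rows.slice t) type (Rows.slice-∑-≤ t))
      (λ a → Y-grid.crossings-≥ (yCrossings (type a)) (proj₁ (y-within a)) (proj₂ (y-within a))
                                (yCrossings-< (type a)))

Feasible : ℕ → ℕ → ℕ → ℕ → Set
Feasible a n b₆ b₉ = (11 ℕ.* n ℕ.+ 24 ℕ.* b₆ ℕ.+ 24 ℕ.* b₉ ℕ.≤ 94)
                   × (42 ℕ.* a ℕ.+ 30 ℕ.* n ℕ.+ 60 ℕ.* b₆ ℕ.+ 90 ℕ.* b₉ ℕ.≤ 356)

WeightBound : ℕ → ℕ → ℕ → ℕ → Set
WeightBound a n b₆ b₉ = 96 ℕ.* a ℕ.+ 72 ℕ.* n ℕ.+ 144 ℕ.* b₆ ℕ.+ 144 ℕ.* b₉ ℕ.≤ 816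

cancel-bound : ∀ k {x} m B → k ℕ.* x ℕ.≤ m → {T (suc m ℕ.≤ᵇ k ℕ.* B)} → x ℕ.< B
cancel-bound k {x} m B kx≤m {m<kB} = ℕ.*-cancelˡ-< k x B (ℕ.≤-<-trans kx≤m (ℕ.≤ᵇ⇒≤ (suc m) (k ℕ.* B) m<kB))

-- Integrality matters here: the linear relaxation allows weights up to about 843.
feasible⇒weightBound : ∀ a n b₆ b₉ → Feasible a n b₆ b₉ → WeightBound a n b₆ b₉
feasible⇒weightBound a n b₆ b₉ feasible@(column , row) = checked a<9 n<9 b₆<4 b₉<4 feasible
  where
  Claim : ℕ → ℕ → ℕ → ℕ → Set
  Claim a n b₆ b₉ = Feasible a n b₆ b₉ → WeightBound a n b₆ b₉
  claim? : ∀ a n b₆ b₉ → Dec (Claim a n b₆ b₉)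
  claim? a n b₆ b₉ = ((11 ℕ.* n ℕ.+ 24 ℕ.* b₆ ℕ.+ 24 ℕ.* b₉ ℕ.≤? 94)
                   ×-dec (42 ℕ.* a ℕ.+ 30 ℕ.* n ℕ.+ 60 ℕ.* b₆ ℕ.+ 90 ℕ.* b₉ ℕ.≤? 356))
                   →-dec (96 ℕ.* a ℕ.+ 72 ℕ.* n ℕ.+ 144 ℕ.* b₆ ℕ.+ 144 ℕ.* b₉ ℕ.≤? 816)
  checked : ∀ {a} → a ℕ.< 9 → ∀ {n} → n ℕ.< 9 → ∀ {b₆} → b₆ ℕ.< 4 → ∀ {b₉} → b₉ ℕ.< 4 → Claim a n b₆ b₉
  checked = toWitness {a? = ℕ.allUpTo? (λ a → ℕ.allUpTo? (λ n → ℕ.allUpTo? (λ b₆ →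
                              ℕ.allUpTo? (claim? a n b₆) 4) 4) 9) 9} tt
  a<9 : a ℕ.< 9
  a<9 = cancel-bound 42 356 9 (ℕ.≤-trans (ℕ.m≤m+n (42 ℕ.* a) (30 ℕ.* n))
          (ℕ.≤-trans (ℕ.m≤m+n _ (60 ℕ.* b₆)) (ℕ.≤-trans (ℕ.m≤m+n _ (90 ℕ.* b₉)) row)))
  n<9 : n ℕ.< 9
  n<9 = cancel-bound 11 94 9 (ℕ.≤-trans (ℕ.m≤m+n (11 ℕ.* n) (24 ℕ.* b₆)) (ℕ.≤-trans (ℕ.m≤m+n _ (24 ℕ.* b₉)) column))
  b₆<4 : b₆ ℕ.< 4
  b₆<4 = cancel-bound 24 94 4 (ℕ.≤-trans (ℕ.m≤n+m (24 ℕ.* b₆) (11 ℕ.* n)) (ℕ.≤-trans (ℕ.m≤m+n _ (24 ℕ.* b₉)) column))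
  b₉<4 : b₉ ℕ.< 4
  b₉<4 = cancel-bound 24 94 4 (ℕ.≤-trans (ℕ.m≤n+m (24 ℕ.* b₉) (11 ℕ.* n ℕ.+ 24 ℕ.* b₆)) column)

weightTerms : List (ℕ × Fin 9)
weightTerms = (48 , type₂) ∷ (96 , type₃) ∷ (72 , type₄) ∷ (72 , type₅)
            ∷ (144 , type₆) ∷ (72 , type₇) ∷ (72 , type₈) ∷ (144 , type₉) ∷ []

weightNumerator : Pattern → ℕ
weightNumerator v = ∑ℕ weightTerms (λ (k , i) → k ℕ.* v i)

w-≡ : ∀ v → w v ≡ c (weightNumerator v) * (+ 1 / 413)
w-≡ v = begin
  w v
    ≡⟨ solve 8 (λ x₂ x₃ x₄ x₅ x₆ x₇ x₈ x₉ →
         con (+ 48 / 413) :* x₂ :+ con (+ 96 / 413) :* x₃ :+ con (+ 72 / 413) :* x₄ :+ con (+ 72 / 413) :* x₅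
           :+ con (+ 144 / 413) :* x₆ :+ con (+ 72 / 413) :* x₇ :+ con (+ 72 / 413) :* x₈ :+ con (+ 144 / 413) :* x₉
         := con (c 48) :* x₂ :* con r :+ (con (c 96) :* x₃ :* con r :+ (con (c 72) :* x₄ :* con r
           :+ (con (c 72) :* x₅ :* con r :+ (con (c 144) :* x₆ :* con r :+ (con (c 72) :* x₇ :* con r
           :+ (con (c 72) :* x₈ :* con r :+ (con (c 144) :* x₉ :* con r :+ con 0ℚ))))))))
       refl (c (v type₂)) (c (v type₃)) (c (v type₄)) (c (v type₅))
            (c (v type₆)) (c (v type₇)) (c (v type₈)) (c (v type₉)) ⟩
  ∑ℚ weightTerms (λ (k , i) → c k * c (v i) * r)   ≡⟨ ∑ℚ-cong weightTerms (λ (k , i) → cong (_* r) (c-homo-* k (v i))) ⟩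
  ∑ℚ weightTerms (λ (k , i) → c (k ℕ.* v i) * r)   ≡⟨ ∑ℚ-c-* weightTerms (λ (k , i) → k ℕ.* v i) r ⟩
  c (weightNumerator v) * r                        ∎
  where
  open ≡-Reasoning
  r = + 1 / 413

weightNumerator-≤ : ∀ v → v type₂ ≡ 0 →
                    ∑Fin 9 (λ i → v i ℕ.* (tall i ℕ.* xCrossings i)) ℕ.≤ 94 →
                    ∑Fin 9 (λ i → v i ℕ.* (rowWeight i ℕ.* yCrossings i)) ℕ.≤ 356 →
                    weightNumerator v ℕ.≤ 816
weightNumerator-≤ v v₂≡0 column row =
  subst (ℕ._≤ 816) (≡-sym (numerator-≡ (v type₁) (v type₂) (v type₃) (v type₄) (v type₅) (v type₆) (v type₇) (v type₈) (v type₉) v₂≡0)) $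
  feasible⇒weightBound (v type₃) (v type₄ ℕ.+ v type₅ ℕ.+ v type₇ ℕ.+ v type₈) (v type₆) (v type₉)
    ( subst (ℕ._≤ 94) (column-≡ (v type₁) (v type₂) (v type₃) (v type₄) (v type₅) (v type₆) (v type₇) (v type₈) (v type₉)) column
    , subst (ℕ._≤ 356) (row-≡ (v type₁) (v type₂) (v type₃) (v type₄) (v type₅) (v type₆) (v type₇) (v type₈) (v type₉)) row)
  where
  column-≡ : ∀ v₁ v₂ v₃ v₄ v₅ v₆ v₇ v₈ v₉ →
    v₁ ℕ.* 0 ℕ.+ (v₂ ℕ.* 0 ℕ.+ (v₃ ℕ.* 0 ℕ.+ (v₄ ℕ.* 11 ℕ.+ (v₅ ℕ.* 11 ℕ.+ (v₆ ℕ.* 24 ℕ.+ (v₇ ℕ.* 11 ℕ.+ (v₈ ℕ.* 11 ℕ.+ (v₉ ℕ.* 24 ℕ.+ 0))))))))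
    ≡ 11 ℕ.* (v₄ ℕ.+ v₅ ℕ.+ v₇ ℕ.+ v₈) ℕ.+ 24 ℕ.* v₆ ℕ.+ 24 ℕ.* v₉
  column-≡ = solve-∀
  row-≡ : ∀ v₁ v₂ v₃ v₄ v₅ v₆ v₇ v₈ v₉ →
    v₁ ℕ.* 0 ℕ.+ (v₂ ℕ.* 0 ℕ.+ (v₃ ℕ.* 42 ℕ.+ (v₄ ℕ.* 30 ℕ.+ (v₅ ℕ.* 30 ℕ.+ (v₆ ℕ.* 60 ℕ.+ (v₇ ℕ.* 30 ℕ.+ (v₈ ℕ.* 30 ℕ.+ (v₉ ℕ.* 90 ℕ.+ 0))))))))
    ≡ 42 ℕ.* v₃ ℕ.+ 30 ℕ.* (v₄ ℕ.+ v₅ ℕ.+ v₇ ℕ.+ v₈) ℕ.+ 60 ℕ.* v₆ ℕ.+ 90 ℕ.* v₉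
  row-≡ = solve-∀
  numerator-≡ : ∀ v₁ v₂ v₃ v₄ v₅ v₆ v₇ v₈ v₉ → v₂ ≡ 0 →
    48 ℕ.* v₂ ℕ.+ (96 ℕ.* v₃ ℕ.+ (72 ℕ.* v₄ ℕ.+ (72 ℕ.* v₅ ℕ.+ (144 ℕ.* v₆ ℕ.+ (72 ℕ.* v₇ ℕ.+ (72 ℕ.* v₈ ℕ.+ (144 ℕ.* v₉ ℕ.+ 0)))))))
    ≡ 96 ℕ.* v₃ ℕ.+ 72 ℕ.* (v₄ ℕ.+ v₅ ℕ.+ v₇ ℕ.+ v₈) ℕ.+ 144 ℕ.* v₆ ℕ.+ 144 ℕ.* v₉
  numerator-≡ v₁ .0 v₃ v₄ v₅ v₆ v₇ v₈ v₉ refl = lemma v₃ v₄ v₅ v₆ v₇ v₈ v₉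
    where
    lemma : ∀ v₃ v₄ v₅ v₆ v₇ v₈ v₉ →
      96 ℕ.* v₃ ℕ.+ (72 ℕ.* v₄ ℕ.+ (72 ℕ.* v₅ ℕ.+ (144 ℕ.* v₆ ℕ.+ (72 ℕ.* v₇ ℕ.+ (72 ℕ.* v₈ ℕ.+ (144 ℕ.* v₉ ℕ.+ 0))))))
      ≡ 96 ℕ.* v₃ ℕ.+ 72 ℕ.* (v₄ ℕ.+ v₅ ℕ.+ v₇ ℕ.+ v₈) ℕ.+ 144 ℕ.* v₆ ℕ.+ 144 ℕ.* v₉
    lemma = solve-∀

w-≤-w-pstar : ∀ v → weightNumerator v ℕ.≤ 816 → w v ≤ w pstar
w-≤-w-pstar v bound = subst₂ _≤_ (≡-sym (w-≡ v)) (≡-sym (w-≡ pstar))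
  (*-monoʳ-≤-nonNeg (+ 1 / 413) (c-mono-≤ bound))

-- A packing of p*

-- Left: two type-4 items at x = 0 under two type-3 items ending exactly at y = 1.
-- Middle: two type-3 items at x = 1/4, y = 0 under type-4 items at x = 1/4, 1/2.
-- Right: two type-4 items at x = 3/4 resting on the bottom type-3 items, which
-- reach past x = 3/4; their heights 1/3 + ε then end exactly at y = 1.
placement : Item pstar → Lin × Lin
placement (type₃ , zero) = const 0ℚ , const (+ 5 / 6) ⊕ c 2 ⊛ ε̂
placement (type₃ , suc zero) = const 0ℚ , const (+ 2 / 3) ⊕ c 2 ⊛ ε̂
placement (type₃ , suc (suc zero)) = const (+ 1 / 4) , const 0ℚ
placement (type₃ , suc (suc (suc zero))) = const (+ 1 / 4) , const (+ 1 / 6)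
placement (type₄ , zero) = const 0ℚ , const 0ℚ
placement (type₄ , suc zero) = const 0ℚ , const (+ 1 / 3) ⊕ ε̂
placement (type₄ , suc (suc zero)) = const (+ 1 / 4) , const (+ 1 / 3)
placement (type₄ , suc (suc (suc zero))) = const (+ 1 / 2) , const (+ 1 / 3)
placement (type₄ , suc (suc (suc (suc zero)))) = const (+ 3 / 4) , const (+ 1 / 3) ⊖ c 2 ⊛ ε̂
placement (type₄ , suc (suc (suc (suc (suc zero))))) = const (+ 3 / 4) , const (+ 2 / 3) ⊖ ε̂

xᴸ yᴸ : Item pstar → Lin
xᴸ = proj₁ ∘ placement
yᴸ = proj₂ ∘ placement

pairCheckᴸ : Item pstar → Item pstar → Bool
pairCheckᴸ a b = isYes (a ≟ᵢ b) ∨ disjointᴸ (xᴸ a) (yᴸ a) (widthᴸ (type a)) (heightᴸ (type a))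
                                             (xᴸ b) (yᴸ b) (widthᴸ (type b)) (heightᴸ (type b))

module PstarPacking (ε δ : ℚ) (0<ε : 0ℚ < ε) (ε<ε-max : ε < ε-max) (0<δ : 0ℚ < δ) (δ<δ-max : δ < δ-max) where
  open Box ε δ 0<ε ε<ε-max 0<δ δ<δ-max

  position : Item pstar → ℚ × ℚ
  position a = ⟪ xᴸ a ⟫ , ⟪ yᴸ a ⟫

  inside : ∀ a → (0ℚ ≤ ⟪ xᴸ a ⟫) × (⟪ xᴸ a ⟫ + width ε δ (type a) ≤ 1ℚ)
               × (0ℚ ≤ ⟪ yᴸ a ⟫) × (⟪ yᴸ a ⟫ + height ε δ (type a) ≤ 1ℚ)
  inside a = subst₂ (λ wa ha → (0ℚ ≤ ⟪ xᴸ a ⟫) × (⟪ xᴸ a ⟫ + wa ≤ 1ℚ) × (0ℚ ≤ ⟪ yᴸ a ⟫) × (⟪ yᴸ a ⟫ + ha ≤ 1ℚ))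
    (widthᴸ-correct ε δ (type a)) (heightᴸ-correct ε δ (type a))
    (inUnitSquareᴸ-sound (xᴸ a) (yᴸ a) (widthᴸ (type a)) (heightᴸ (type a))
      (allItems-sound pstar (λ a → inUnitSquareᴸ (xᴸ a) (yᴸ a) (widthᴸ (type a)) (heightᴸ (type a))) tt a))

  checked-pairs : ∀ a b → T (pairCheckᴸ a b)
  checked-pairs a = allItems-sound pstar (pairCheckᴸ a)
    (allItems-sound pstar (λ a → allItems pstar (pairCheckᴸ a)) tt a)

  disjoint : ∀ a b → a ≢ b →
    DisjointInteriors ⟪ xᴸ a ⟫ ⟪ yᴸ a ⟫ (width ε δ (type a)) (height ε δ (type a))
                      ⟪ xᴸ b ⟫ ⟪ yᴸ b ⟫ (width ε δ (type b)) (height ε δ (type b))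
  disjoint a b a≢b = separated (distinct-∨ (a ≟ᵢ b) separatedᴸ a≢b (checked-pairs a b))
    where
    separatedᴸ : Bool
    separatedᴸ = disjointᴸ (xᴸ a) (yᴸ a) (widthᴸ (type a)) (heightᴸ (type a))
                          (xᴸ b) (yᴸ b) (widthᴸ (type b)) (heightᴸ (type b))
    separated : T separatedᴸ →
                DisjointInteriors ⟪ xᴸ a ⟫ ⟪ yᴸ a ⟫ (width ε δ (type a)) (height ε δ (type a))
                                  ⟪ xᴸ b ⟫ ⟪ yᴸ b ⟫ (width ε δ (type b)) (height ε δ (type b))
    separated t = resize (widthᴸ-correct ε δ (type a)) (heightᴸ-correct ε δ (type a))
                         (widthᴸ-correct ε δ (type b)) (heightᴸ-correct ε δ (type b))
      (disjointᴸ-sound (xᴸ a) (yᴸ a) (widthᴸ (type a)) (heightᴸ (type a))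
                                            (xᴸ b) (yᴸ b) (widthᴸ (type b)) (heightᴸ (type b)) t)
      where
      resize : ∀ {wa ha wb hb} → ⟪ widthᴸ (type a) ⟫ ≡ wa → ⟪ heightᴸ (type a) ⟫ ≡ ha →
               ⟪ widthᴸ (type b) ⟫ ≡ wb → ⟪ heightᴸ (type b) ⟫ ≡ hb →
               DisjointInteriors ⟪ xᴸ a ⟫ ⟪ yᴸ a ⟫ ⟪ widthᴸ (type a) ⟫ ⟪ heightᴸ (type a) ⟫
                                 ⟪ xᴸ b ⟫ ⟪ yᴸ b ⟫ ⟪ widthᴸ (type b) ⟫ ⟪ heightᴸ (type b) ⟫ →
               DisjointInteriors ⟪ xᴸ a ⟫ ⟪ yᴸ a ⟫ wa ha ⟪ xᴸ b ⟫ ⟪ yᴸ b ⟫ wb hb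
      resize refl refl refl refl d = d

  pstar-packable : Packable ε δ pstar
  pstar-packable = position , inside , disjoint

lemma3 : Σ ℚ λ ε₀ → Σ ℚ λ δ₀ → (0ℚ < ε₀) × (0ℚ < δ₀) ×
           ((ε δ : ℚ) → 0ℚ < ε → ε < ε₀ → 0ℚ < δ → δ < δ₀ →
             (InT3 pstar × Packable ε δ pstar) ×
             ((p : Pattern) → InT3 p → Packable ε δ p → w p ≤ w pstar))
lemma3 = ε-max , δ-max , toWitness {a? = 0ℚ <? ε-max} tt , toWitness {a? = 0ℚ <? δ-max} tt ,
  λ ε δ 0<ε ε<ε-max 0<δ δ<δ-max →
    ((refl , refl , λ ()) , PstarPacking.pstar-packable ε δ 0<ε ε<ε-max 0<δ δ<δ-max) ,
    λ p (_ , p₂≡0 , _) packing →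
      let open Counting ε δ 0<ε ε<ε-max 0<δ δ<δ-max p packing
      in w-≤-w-pstar p (weightNumerator-≤ p p₂≡0 column-count row-count)
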